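{- Let $\tau$ be a labelling set, $\tau_1,\tau_2$ normal closed subsets of $\tau$, and $p,q,r\in\tau$. If $(T,\alpha)$ is any $\tau$-scheme and $(y,z)\in r\alpha$, then the cardinality $|\,y(p\alpha)(\tau_1\alpha)\cap z(q\alpha)^*(\tau_2\alpha)\,|$ depends only on $\tau_1,\tau_2,p,q,r$ (and not on $(T,\alpha)$ or $(y,z)$).
   Context: All schemes are association schemes on finite sets. For a scheme $T$ on $X$, $x\in X$, $P\subseteq T$: $xP=\bigcup_{s\in P}\{x':(x,x')\in s\}$; complex products $PQ=\{r:a_{pqr}>0$ for some $p\in P,q\in Q\}$ (so $y(p\alpha)(\tau_1\alpha)$ means $y$ applied to the complex product $\{p\alpha\}(\tau_1\alpha)$). A weak labelling set is a set $\tau$ with an involution $p\mapsto p^*$, a distinguished element $1$ fixed by $*$, and nonnegative integers $a^\tau_{pqr}$ for all $p,q,r\in\tau$. A $\tau$-scheme is a pair $(T,\alpha)$ with $T$ a scheme on a based set $X$ and $\alpha:\tau\to T$ a bijection with $1\alpha=1_X$, $(p^*)\alpha=(p\alpha)^*$, and $a_{(p\alpha)(q\alpha)(r\alpha)}=a^\tau_{pqr}$. A labelling set is a weak labelling set for which some $\tau$-scheme exists. For $P,Q\subseteq\tau$, $PQ=\{r\in\tau:a^\tau_{pqr}>0$ for some $p\in P,q\in Q\}$. A subset $\tau'\subseteq\tau$ is closed if $pq^*\subseteq\tau'$ for all $p,q\in\tau'$, and normal if $p\tau'=\tau'p$ for all $p\in\tau$. -}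

module Defs where

open import Data.Nat using (ℕ; zero; suc; _<_)
open import Data.Fin using (Fin; zero; suc; _≟_)
open import Data.Fin.Subset using (Subset; _∈_)
open import Data.Fin.Subset.Properties using (_∈?_)
open import Data.Fin.Properties using (any?)
open import Data.Product using (Σ; ∃; ∃-syntax; _×_; _,_)
open import Relation.Nullary using (Dec; yes; no)
open import Relation.Nullary.Decidable using (_×-dec_)
open import Relation.Binary.PropositionalEquality using (_≡_)
open import Function.Bundles using (_⇔_)

count : ∀ {n} (P : Fin n → Set) → (∀ i → Dec (P i)) → ℕ
count {zero} P P? = 0
count {suc n} P P? with P? zero
... | yes _ = suc (count (λ i → P (suc i)) (λ i → P? (suc i)))
... | no _ = count (λ i → P (suc i)) (λ i → P? (suc i))

-- A weak labelling set.  A labelling set is necessarily finite (it is in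
-- bijection with the relations of a scheme on a finite set), so its
-- underlying set is taken to be Fin size.
record WeakLabellingSet : Set where
  field
    size  : ℕ
    star  : Fin size → Fin size
    star-invol : ∀ p → star (star p) ≡ p
    one   : Fin size
    star-one : star one ≡ one
    a     : Fin size → Fin size → Fin size → ℕ

module _ (τ : WeakLabellingSet) where
  open WeakLabellingSet τ

  -- A τ-scheme (T, α): a scheme T on the based set X = Fin n, encoded by the
  -- map rel : X × X → τ with rel x y = p  iff  (x,y) ∈ pα.  Since the
  -- relations of T are the fibres of rel, T is a partition of X × X, and α
  -- is a bijection iff every fibre is nonempty (surj).
  record TauScheme : Set where
    field
      n     : ℕ
      rel   : Fin n → Fin n → Fin size
      surj  : ∀ p → ∃[ x ] ∃[ y ] rel x y ≡ p
      rel-one : ∀ x y → (rel x y ≡ one) ⇔ (x ≡ y)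
      rel-star : ∀ x y → rel y x ≡ star (rel x y)
      rel-int : ∀ p q r x y → rel x y ≡ r →
        count (λ w → rel x w ≡ p × rel w y ≡ q)
              (λ w → (rel x w ≟ p) ×-dec (rel w y ≟ q)) ≡ a p q r

  IsLabellingSet : Set
  IsLabellingSet = TauScheme

  _∈[_⋆_] : Fin size → Fin size → Subset size → Set
  r ∈[ p ⋆ Q ] = ∃[ q ] (q ∈ Q × 0 < a p q r)

  _∈[_⋆'_] : Fin size → Subset size → Fin size → Set
  r ∈[ Q ⋆' p ] = ∃[ q ] (q ∈ Q × 0 < a q p r)

  Closed : Subset size → Set
  Closed τ' = ∀ p q r → p ∈ τ' → q ∈ τ' → 0 < a p (star q) r → r ∈ τ'

  Normal : Subset size → Set
  Normal τ' = ∀ p r → (r ∈[ p ⋆ τ' ]) ⇔ (r ∈[ τ' ⋆' p ])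

  module _ (T : TauScheme) where
    open TauScheme T

    InProdT : Fin size → Subset size → Fin size → Set
    InProdT p Q s = ∃[ x ] ∃[ u ] ∃[ v ] (rel x u ≡ p × rel u v ∈ Q × rel x v ≡ s)

    inProdT? : ∀ p Q s → Dec (InProdT p Q s)
    inProdT? p Q s = any? λ x → any? λ u → any? λ v →
      (rel x u ≟ p) ×-dec ((rel u v ∈? Q) ×-dec (rel x v ≟ s))

    -- s ∈ {(qα)*}(Qα), computed in T: (x,u) ∈ (qα)* means (u,x) ∈ qα.
    InProdStarT : Fin size → Subset size → Fin size → Set
    InProdStarT q Q s = ∃[ x ] ∃[ u ] ∃[ v ] (rel u x ≡ q × rel u v ∈ Q × rel x v ≡ s)

    inProdStarT? : ∀ q Q s → Dec (InProdStarT q Q s)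
    inProdStarT? q Q s = any? λ x → any? λ u → any? λ v →
      (rel u x ≟ q) ×-dec ((rel u v ∈? Q) ×-dec (rel x v ≟ s))

    interCard : Subset size → Subset size → Fin size → Fin size → Fin n → Fin n → ℕ
    interCard τ₁ τ₂ p q y z =
      count (λ w → InProdT p τ₁ (rel y w) × InProdStarT q τ₂ (rel z w))
            (λ w → inProdT? p τ₁ (rel y w) ×-dec inProdStarT? q τ₂ (rel z w))

-- Split each w ∈ X according to the pair of relations (rel y w, rel z w) = (s, t).
-- Membership of w in y(pα)(τ₁α) ∩ z(qα)*(τ₂α) depends only on that pair, because
-- the complex products computed inside a τ-scheme agree with those of τ; and the
-- fibre over (s, t) has a_{s t* r} elements when (y, z) ∈ rα.  Hence the
-- cardinality is  ∑_{s ∈ pτ₁} ∑_{t ∈ q*τ₂} a_{s t* r}.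
module Submission where

open import Defs
open import Data.Bool.Base using (true; false; if_then_else_)
open import Data.Nat using (ℕ; zero; suc; _*_; _<_; _<?_; z≤n; s≤s)
open import Data.Nat.Properties
  using (+-*-semiring; +-identityʳ; *-assoc; *-comm)
open import Algebra.Properties.Semiring.Sum +-*-semiring
  using (sum-syntax; sum-cong-≗; sum-replicate-zero; ∑-comm; *-distribˡ-sum)
open import Data.Fin using (Fin; zero; suc; _≟_)
open import Data.Fin.Properties using (any?)
open import Data.Fin.Subset using (Subset; _∈_)
open import Data.Fin.Subset.Properties using (_∈?_)
open import Data.Product using (∃; ∃-syntax; _×_; _,_)
open import Function using (_∘_)
open import Function.Bundles using (_⇔_; mk⇔; Equivalence)
open import Function.Construct.Symmetry using (⇔-sym)
open import Function.Construct.Identity using (⇔-id)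
open import Function.Construct.Composition using (_⇔-∘_)
open import Data.Product.Function.NonDependent.Propositional using (_×-⇔_)
open import Relation.Nullary using (Dec; yes; no; does; contradiction)
open import Relation.Nullary.Decidable using (_×-dec_; does-⇔)
open import Relation.Binary.PropositionalEquality
  using (_≡_; refl; sym; trans; cong; subst; module ≡-Reasoning)

𝟙 : {P : Set} → Dec P → ℕ
𝟙 P? = if does P? then 1 else 0

𝟙-⇔ : {P Q : Set} → P ⇔ Q → (P? : Dec P) (Q? : Dec Q) → 𝟙 P? ≡ 𝟙 Q?
𝟙-⇔ P⇔Q P? Q? = cong (λ b → if b then 1 else 0) (does-⇔ P⇔Q P? Q?)

𝟙-×-dec : {P Q : Set} (P? : Dec P) (Q? : Dec Q) → 𝟙 (P? ×-dec Q?) ≡ 𝟙 P? * 𝟙 Q?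
𝟙-×-dec P? Q? with does P?
... | true  = sym (+-identityʳ _)
... | false = refl

∑-𝟙-≟ : ∀ {m} (g : Fin m → ℕ) (x : Fin m) → ∑[ s < m ] (𝟙 (x ≟ s) * g s) ≡ g x
∑-𝟙-≟ {suc m} g zero
  rewrite sum-replicate-zero m | +-identityʳ (g zero) = +-identityʳ (g zero)
∑-𝟙-≟ g (suc x) = ∑-𝟙-≟ (g ∘ suc) x

count≡∑𝟙 : ∀ {n} (P : Fin n → Set) (P? : ∀ i → Dec (P i)) →
  count P P? ≡ ∑[ i < n ] 𝟙 (P? i)
count≡∑𝟙 {zero}  P P? = refl
count≡∑𝟙 {suc n} P P? with P? zero
... | yes _ = cong suc (count≡∑𝟙 (P ∘ suc) (P? ∘ suc))
... | no  _ = count≡∑𝟙 (P ∘ suc) (P? ∘ suc)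

count-cong : ∀ {n} {P Q : Fin n → Set} → (∀ i → P i ⇔ Q i) →
  (P? : ∀ i → Dec (P i)) (Q? : ∀ i → Dec (Q i)) → count P P? ≡ count Q Q?
count-cong {P = P} {Q} P⇔Q P? Q? = begin
  count P P?            ≡⟨ count≡∑𝟙 P P? ⟩
  ∑[ i < _ ] 𝟙 (P? i)   ≡⟨ sum-cong-≗ (λ i → 𝟙-⇔ (P⇔Q i) (P? i) (Q? i)) ⟩
  ∑[ i < _ ] 𝟙 (Q? i)   ≡⟨ count≡∑𝟙 Q Q? ⟨
  count Q Q?            ∎
  where open ≡-Reasoning

count-pos⇒∃ : ∀ {n} (P : Fin n → Set) (P? : ∀ i → Dec (P i)) → 0 < count P P? → ∃ P
count-pos⇒∃ {suc n} P P? pos with P? zero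
... | yes p = zero , p
... | no  _ with count-pos⇒∃ (P ∘ suc) (P? ∘ suc) pos
...   | i , p = suc i , p

∃⇒count-pos : ∀ {n} (P : Fin n → Set) (P? : ∀ i → Dec (P i)) → ∃ P → 0 < count P P?
∃⇒count-pos {suc n} P P? (i , p) with P? zero
∃⇒count-pos P P? (_     , _) | yes _ = s≤s z≤n
∃⇒count-pos P P? (zero  , p) | no ¬p = contradiction p ¬p
∃⇒count-pos P P? (suc i , p) | no _  = ∃⇒count-pos (P ∘ suc) (P? ∘ suc) (i , p)

∑-fibres₂ : ∀ {n k l} (f : Fin n → Fin k) (h : Fin n → Fin l) (g : Fin k → Fin l → ℕ) →
  ∑[ w < n ] g (f w) (h w) ≡
  ∑[ s < k ] ∑[ t < l ] (g s t * count (λ w → f w ≡ s × h w ≡ t) (λ w → (f w ≟ s) ×-dec (h w ≟ t)))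
∑-fibres₂ {n} {k} {l} f h g = begin
  ∑[ w < n ] g (f w) (h w)
    ≡⟨ sum-cong-≗ (λ w → sym (trans (sum-cong-≗ (λ s → cong (𝟙 (f w ≟ s) *_) (∑-𝟙-≟ (g s) (h w))))
                                     (∑-𝟙-≟ (λ s → g s (h w)) (f w)))) ⟩
  ∑[ w < n ] ∑[ s < k ] (𝟙 (f w ≟ s) * ∑[ t < l ] (𝟙 (h w ≟ t) * g s t))
    ≡⟨ sum-cong-≗ (λ w → sum-cong-≗ (λ s → *-distribˡ-sum {l} (𝟙 (f w ≟ s)) (λ t → 𝟙 (h w ≟ t) * g s t))) ⟩
  ∑[ w < n ] ∑[ s < k ] ∑[ t < l ] δ w s t
    ≡⟨ ∑-comm (λ w s → ∑[ t < l ] δ w s t) ⟩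
  ∑[ s < k ] ∑[ w < n ] ∑[ t < l ] δ w s t
    ≡⟨ sum-cong-≗ (λ s → ∑-comm (λ w t → δ w s t)) ⟩
  ∑[ s < k ] ∑[ t < l ] ∑[ w < n ] δ w s t
    ≡⟨ sum-cong-≗ (λ s → sum-cong-≗ (λ t → fibre s t)) ⟩
  ∑[ s < k ] ∑[ t < l ] (g s t * count (λ w → f w ≡ s × h w ≡ t) (λ w → (f w ≟ s) ×-dec (h w ≟ t))) ∎
  where
  open ≡-Reasoning
  δ : Fin n → Fin k → Fin l → ℕ
  δ w s t = 𝟙 (f w ≟ s) * (𝟙 (h w ≟ t) * g s t)
  fibre : ∀ s t → ∑[ w < n ] δ w s t ≡
    g s t * count (λ w → f w ≡ s × h w ≡ t) (λ w → (f w ≟ s) ×-dec (h w ≟ t))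
  fibre s t = begin
    ∑[ w < n ] δ w s t
      ≡⟨ sum-cong-≗ (λ w → trans (sym (*-assoc (𝟙 (f w ≟ s)) _ _)) (*-comm _ (g s t))) ⟩
    ∑[ w < n ] (g s t * (𝟙 (f w ≟ s) * 𝟙 (h w ≟ t)))
      ≡⟨ *-distribˡ-sum {n} (g s t) (λ w → 𝟙 (f w ≟ s) * 𝟙 (h w ≟ t)) ⟨
    g s t * ∑[ w < n ] (𝟙 (f w ≟ s) * 𝟙 (h w ≟ t))
      ≡⟨ cong (g s t *_) (sum-cong-≗ (λ w → sym (𝟙-×-dec (f w ≟ s) (h w ≟ t)))) ⟩
    g s t * ∑[ w < n ] 𝟙 ((f w ≟ s) ×-dec (h w ≟ t))
      ≡⟨ cong (g s t *_) (count≡∑𝟙 (λ w → f w ≡ s × h w ≡ t) _) ⟨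
    g s t * count (λ w → f w ≡ s × h w ≡ t) (λ w → (f w ≟ s) ×-dec (h w ≟ t)) ∎

module _ (τ : WeakLabellingSet) where
  open WeakLabellingSet τ

  star-injective : ∀ {p q} → star p ≡ star q → p ≡ q
  star-injective {p} {q} e = trans (sym (star-invol p)) (trans (cong star e) (star-invol q))

  _∈[_⋆_]? : ∀ s p Q → Dec (_∈[_⋆_] τ s p Q)
  s ∈[ p ⋆ Q ]? = any? λ q → (q ∈? Q) ×-dec (0 <? a p q s)

  interCardFormula : Subset size → Subset size → Fin size → Fin size → Fin size → ℕ
  interCardFormula τ₁ τ₂ p q r =
    ∑[ s < size ] ∑[ t < size ]
      (𝟙 (s ∈[ p ⋆ τ₁ ]?) * 𝟙 (t ∈[ star q ⋆ τ₂ ]?) * a s (star t) r)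

  module _ (T : TauScheme τ) where
    open TauScheme T

    rel-flip : ∀ x y t → (rel y x ≡ star t) ⇔ (rel x y ≡ t)
    rel-flip x y t = mk⇔ (λ e → star-injective (trans (sym (rel-star x y)) e))
                         (λ e → trans (rel-star x y) (cong star e))

    inProdT⇔∈⋆ : ∀ p Q s → InProdT τ T p Q s ⇔ _∈[_⋆_] τ s p Q
    inProdT⇔∈⋆ p Q s = mk⇔ to from
      where
      to : InProdT τ T p Q s → _∈[_⋆_] τ s p Q
      to (x , u , v , xu≡p , uv∈Q , xv≡s) = rel u v , uv∈Q ,
        subst (0 <_) (rel-int p (rel u v) s x v xv≡s)
          (∃⇒count-pos _ (λ w → (rel x w ≟ p) ×-dec (rel w v ≟ rel u v)) (u , xu≡p , refl))
      from : _∈[_⋆_] τ s p Q → InProdT τ T p Q s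
      -- Any (x, v) ∈ sα, which exists as α is onto, has a_{pqs} > 0 points u between.
      from (q , q∈Q , a>0) with surj s
      ... | x , v , xv≡s with count-pos⇒∃ _ (λ w → (rel x w ≟ p) ×-dec (rel w v ≟ q))
                                (subst (0 <_) (sym (rel-int p q s x v xv≡s)) a>0)
      ... | u , xu≡p , uv≡q = x , u , v , xu≡p , subst (_∈ Q) (sym uv≡q) q∈Q , xv≡s

    inProdStarT⇔inProdT-star : ∀ q Q s → InProdStarT τ T q Q s ⇔ InProdT τ T (star q) Q s
    inProdStarT⇔inProdT-star q Q s = mk⇔
      (λ (x , u , v , ux≡q , uv∈Q , xv≡s) → x , u , v , Equivalence.from (rel-flip u x q) ux≡q , uv∈Q , xv≡s)
      (λ (x , u , v , xu≡q* , uv∈Q , xv≡s) → x , u , v , Equivalence.to (rel-flip u x q) xu≡q* , uv∈Q , xv≡s)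

    count-fibre≡a : ∀ {y z r} s t → rel y z ≡ r →
      count (λ w → rel y w ≡ s × rel z w ≡ t) (λ w → (rel y w ≟ s) ×-dec (rel z w ≟ t)) ≡ a s (star t) r
    count-fibre≡a {y} {z} {r} s t yz≡r = trans
      (count-cong (λ w → ⇔-id _ ×-⇔ ⇔-sym (rel-flip z w t)) _ (λ w → (rel y w ≟ s) ×-dec (rel w z ≟ star t)))
      (rel-int s (star t) r y z yz≡r)

    interCard≡interCardFormula : ∀ τ₁ τ₂ p q r y z → rel y z ≡ r →
      interCard τ T τ₁ τ₂ p q y z ≡ interCardFormula τ₁ τ₂ p q r
    interCard≡interCardFormula τ₁ τ₂ p q r y z yz≡r = begin
      interCard τ T τ₁ τ₂ p q y z
        ≡⟨ count-cong (λ w → inProdT⇔∈⋆ p τ₁ (rel y w)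
                               ×-⇔ (inProdT⇔∈⋆ (star q) τ₂ (rel z w) ⇔-∘ inProdStarT⇔inProdT-star q τ₂ (rel z w)))
                      _ both? ⟩
      count Both both?
        ≡⟨ count≡∑𝟙 Both both? ⟩
      ∑[ w < n ] 𝟙 (both? w)
        ≡⟨ sum-cong-≗ (λ w → 𝟙-×-dec (rel y w ∈[ p ⋆ τ₁ ]?) (rel z w ∈[ star q ⋆ τ₂ ]?)) ⟩
      ∑[ w < n ] g (rel y w) (rel z w)
        ≡⟨ ∑-fibres₂ (rel y) (rel z) g ⟩
      ∑[ s < size ] ∑[ t < size ] (g s t * count _ (λ w → (rel y w ≟ s) ×-dec (rel z w ≟ t)))
        ≡⟨ sum-cong-≗ (λ s → sum-cong-≗ (λ t → cong (g s t *_) (count-fibre≡a s t yz≡r))) ⟩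
      interCardFormula τ₁ τ₂ p q r ∎
      where
      open ≡-Reasoning
      Both : Fin n → Set
      Both w = _∈[_⋆_] τ (rel y w) p τ₁ × _∈[_⋆_] τ (rel z w) (star q) τ₂
      both? : ∀ w → Dec (Both w)
      both? w = rel y w ∈[ p ⋆ τ₁ ]? ×-dec rel z w ∈[ star q ⋆ τ₂ ]?
      g : Fin size → Fin size → ℕ
      g s t = 𝟙 (s ∈[ p ⋆ τ₁ ]?) * 𝟙 (t ∈[ star q ⋆ τ₂ ]?)

-- The count does not need τ₁, τ₂ to be normal or closed, nor τ to be a labelling set.
lemma4p7 : (τ : WeakLabellingSet) → IsLabellingSet τ →
    (τ₁ τ₂ : Subset (WeakLabellingSet.size τ)) →
    Normal τ τ₁ → Closed τ τ₁ → Normal τ τ₂ → Closed τ τ₂ →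
    (p q r : Fin (WeakLabellingSet.size τ)) →
    ∃[ c ] ((T : TauScheme τ) → (y z : Fin (TauScheme.n T)) →
    TauScheme.rel T y z ≡ r → interCard τ T τ₁ τ₂ p q y z ≡ c)
lemma4p7 τ _ τ₁ τ₂ _ _ _ _ p q r =
  interCardFormula τ τ₁ τ₂ p q r ,
  λ T y z → interCard≡interCardFormula τ T τ₁ τ₂ p q r y z
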